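{- For every nonnegative integer $t$ there exists $r_0\in\mathbb N$ such that for every prime $r\ge r_0$ the following holds. If $f:[r+t]\to[r]$ is a uniformly random surjective function, then the probability that $\sum_{i=1}^r f(i)$ is congruent to $r(r+1)/2$ modulo $r$ is greater than $1/r$. -}

module Defs where

open import Data.Nat using (ℕ; zero; suc; _+_; _*_; _/_; _%_)
open import Data.Fin using (Fin; toℕ; _≟_)
open import Data.Fin.Properties using (all?; any?)
open import Data.Vec as Vec using (Vec; []; _∷_; lookup; take)
open import Data.List as List using (List; [_]; concatMap; allFin; filter; length)
open import Data.Nat using (∣_-_∣)
open import Data.Nat.Divisibility using (_∣_; _∣?_)
open import Relation.Nullary using (Dec)

-- All functions [n] → [m], represented as vectors of length n with
-- entries in Fin m (entry i is the value at the point i+1, value k : Fin m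
-- stands for k+1 ∈ [m]).  Each function appears exactly once.
allFuns : (n m : ℕ) → List (Vec (Fin m) n)
allFuns zero    m = [ [] ]
allFuns (suc n) m = concatMap (λ x → List.map (x ∷_) (allFuns n m)) (allFin m)

Surjective : ∀ {n m} → Vec (Fin m) n → Set
Surjective {n} {m} v = ∀ (j : Fin m) → Data.Product.∃ λ (i : Fin n) → lookup v i Relation.Binary.PropositionalEquality.≡ j
  where import Data.Product
        import Relation.Binary.PropositionalEquality

surjective? : ∀ {n m} (v : Vec (Fin m) n) → Dec (Surjective v)
surjective? v = all? (λ j → any? (λ i → lookup v i ≟ j))

allSurj : (n m : ℕ) → List (Vec (Fin m) n)
allSurj n m = filter surjective? (allFuns n m)

_≡_[mod_] : ℕ → ℕ → ℕ → Set
a ≡ b [mod r ] = r ∣ ∣ a - b ∣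

-- The event: Σ_{i=1}^r f(i) ≡ r(r+1)/2 (mod r), for f : [r+t] → [r]
-- (values shifted back to [r] = {1,…,r}).
Event : (r t : ℕ) → Vec (Fin r) (r + t) → Set
Event r t v = Vec.sum (Vec.map (λ x → suc (toℕ x)) (take r v)) ≡ (r * (r + 1)) / 2 [mod r ]

event? : (r t : ℕ) (v : Vec (Fin r) (r + t)) → Dec (Event r t v)
event? r t v = r ∣? _

numSurj : (r t : ℕ) → ℕ
numSurj r t = length (allSurj (r + t) r)

numGood : (r t : ℕ) → ℕ
numGood r t = length (filter (event? r t) (allSurj (r + t) r))

{-# OPTIONS --safe #-}
-- Call v : [n] → [r] (values 0, …, r − 1, n = r + t) good if r divides the sum of its first r values.
-- Composing with a permutation s of the positions is a bijection on surjections, so summing over s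
-- the number of surjections v with v ∘ s good gives n! · #good. Conversely fix a surjection v and a
-- transversal p of its fibres (v ∘ p = id), and let τ_c move p y to p (y + c), fixing all other
-- positions: v ∘ τ_c is v with c added (mod r) on the transversal. Hence the first-r sum of
-- v ∘ τ_c ∘ s is base + c · k (mod r), where k counts the first r positions that s sends into the
-- transversal; k ≠ 0 by pigeonhole since t < r. If k < r, k is invertible mod the prime r and some c
-- makes v ∘ τ_c ∘ s good; if k = r, the first r values of v ∘ s are 0, …, r − 1 in some order, so
-- base ≡ r(r − 1)/2 ≡ 0 (r odd) and every c does. As s ↦ τ_c ∘ s is a bijection, this gives
-- r · #{s : v ∘ s good} ≥ n!, strictly for the v that is the identity on the first r positions;
-- summing over v, n! · #surj < r · n! · #good.
module Submission where

open import Data.Empty using (⊥-elim)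
open import Data.Fin as Fin using (Fin; zero; suc; toℕ; fromℕ<; _↑ˡ_; _↑ʳ_; splitAt)
import Data.Fin.Properties as Finₚ
open import Data.Fin.Permutation using (Permutation′; permutation; _⟨$⟩ʳ_; _⟨$⟩ˡ_; inverseˡ; inverseʳ; flip)
open import Data.List as List using (List; []; _∷_; map; length; filter; allFin; concatMap; cartesianProductWith)
import Data.List.Properties as Listₚ
open import Data.List.Membership.Propositional using (_∈_)
open import Data.List.Membership.Propositional.Properties
  using (∈-map⁺; ∈-map⁻; ∈-filter⁺; ∈-filter⁻; ∈-allFin; ∈-cartesianProductWith⁺)
open import Data.List.Membership.Propositional.Properties.WithK using (unique∧set⇒bag)
open import Data.List.Relation.Binary.BagAndSetEquality using (∼bag⇒↭)
open import Data.List.Relation.Binary.Permutation.Propositional using (_↭_)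
import Data.List.Relation.Binary.Permutation.Propositional.Properties as ↭
open import Data.List.Relation.Unary.All using ([])
open import Data.List.Relation.Unary.AllPairs using ([]; _∷_)
open import Data.List.Relation.Unary.Any using (here; there)
open import Data.List.Relation.Unary.Unique.Propositional using (Unique)
import Data.List.Relation.Unary.Unique.Propositional.Properties as Unique
open import Data.Nat
  using (ℕ; zero; suc; _+_; _*_; _∸_; ∣_-_∣; _≤_; _<_; _≥_; z≤n; s≤s; z<s; _%_; _/_; NonZero; >-nonZero)
open import Data.Nat.Coprimality as Coprime using (Coprime; coprime-Bézout; prime⇒coprime)
open import Data.Nat.DivMod
  using (%-distribˡ-+; %-remove-+ʳ; m≡m%n+[m/n]*n; m%n<n; m%n%n≡m%n; m<n⇒m%n≡m; *-/-assoc)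
open import Data.Nat.Divisibility
  using (_∣_; _∣?_; divides; ∣-refl; m%n≡0⇒n∣m; n∣m⇒m%n≡0; m∣m*n; n∣m*n; ∣n⇒∣m*n
        ; ∣m∣n⇒∣m+n; ∣m+n∣m⇒∣n; ∣m∸n∣n⇒∣m)
open import Data.Nat.GCD using (module Bézout)
open import Data.Nat.ListAction using (sum)
open import Data.Nat.ListAction.Properties using (sum-↭)
open import Data.Nat.Primality using (Prime; prime⇒irreducible; prime⇒nonZero)
open import Data.Nat.Properties
open import Algebra.Properties.CommutativeSemigroup +-commutativeSemigroup using (interchange)
open import Algebra.Properties.CommutativeSemigroup *-commutativeSemigroup
  using () renaming (x∙yz≈y∙xz to x*[y*z]≡y*[x*z])
open import Data.Nat.Solver using (module +-*-Solver)
open import Data.Product using (∃₂; ∃-syntax; _,_; proj₁; proj₂; map₂)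
open import Data.Sum using (inj₁; inj₂)
open import Data.Vec as Vec using (Vec; []; _∷_; lookup; tabulate)
import Data.Vec.Properties as Vecₚ
open import Function using (_∘_; id; _↔_; mk↔ₛ′; Inverse; Injective; StrictlySurjective; _⇔_; mk⇔; Equivalence)
open import Relation.Binary.PropositionalEquality
open import Relation.Nullary using (Dec; yes; no; ¬_)
open import Relation.Unary using (Pred; Decidable)

open import Defs

𝟙 : ∀ {p} {P : Set p} → Dec P → ℕ
𝟙 (yes _) = 1
𝟙 (no _)  = 0

module _ {p} {P : Set p} where

  𝟙-yes : P → (d : Dec P) → 𝟙 d ≡ 1
  𝟙-yes _  (yes _) = refl
  𝟙-yes p′ (no ¬p) = ⊥-elim (¬p p′)

  𝟙-no : ¬ P → (d : Dec P) → 𝟙 d ≡ 0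
  𝟙-no ¬p (yes p′) = ⊥-elim (¬p p′)
  𝟙-no _  (no _)   = refl

  𝟙≤1 : (d : Dec P) → 𝟙 d ≤ 1
  𝟙≤1 (yes _) = ≤-refl
  𝟙≤1 (no _)  = z≤n

  𝟙-cong : ∀ {q} {Q : Set q} → (P → Q) → (Q → P) → (d : Dec P) (e : Dec Q) → 𝟙 d ≡ 𝟙 e
  𝟙-cong _ _ (yes _)  (yes _)  = refl
  𝟙-cong f _ (yes p′) (no ¬q)  = ⊥-elim (¬q (f p′))
  𝟙-cong _ g (no ¬p)  (yes q′) = ⊥-elim (¬p (g q′))
  𝟙-cong _ _ (no _)   (no _)   = refl

∑ : ∀ {a} {A : Set a} → List A → (A → ℕ) → ℕ
∑ xs f = sum (map f xs)

-- The body is parsed at application level: ∑[ x ∈ xs ] f x + c means (∑[ x ∈ xs ] f x) + c.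
syntax ∑ xs (λ x → e) = ∑[ x ∈ xs ] e

module _ {a} {A : Set a} where

  ∑-cong : ∀ (xs : List A) {f g : A → ℕ} → (∀ {x} → x ∈ xs → f x ≡ g x) → ∑ xs f ≡ ∑ xs g
  ∑-cong []       eq = refl
  ∑-cong (x ∷ xs) eq = cong₂ _+_ (eq (here refl)) (∑-cong xs (eq ∘ there))

  ∑-mono-≤ : ∀ (xs : List A) {f g : A → ℕ} → (∀ {x} → x ∈ xs → f x ≤ g x) → ∑ xs f ≤ ∑ xs g
  ∑-mono-≤ []       le = z≤n
  ∑-mono-≤ (x ∷ xs) le = +-mono-≤ (le (here refl)) (∑-mono-≤ xs (le ∘ there))

  ∑-mono-< : ∀ {xs : List A} {f g : A → ℕ} {x} →
             (∀ {y} → y ∈ xs → f y ≤ g y) → x ∈ xs → f x < g x → ∑ xs f < ∑ xs g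
  ∑-mono-< le (here refl) lt = +-mono-<-≤ lt (∑-mono-≤ _ (le ∘ there))
  ∑-mono-< le (there x∈)  lt = +-mono-≤-< (le (here refl)) (∑-mono-< (le ∘ there) x∈ lt)

  ∈⇒≤∑ : ∀ {xs : List A} {x} (f : A → ℕ) → x ∈ xs → f x ≤ ∑ xs f
  ∈⇒≤∑ f (here refl) = m≤m+n _ _
  ∈⇒≤∑ f (there x∈)  = ≤-trans (∈⇒≤∑ f x∈) (m≤n+m _ _)

  ∑-const : ∀ (xs : List A) c → ∑[ _ ∈ xs ] c ≡ length xs * c
  ∑-const []       c = refl
  ∑-const (x ∷ xs) c = cong (c +_) (∑-const xs c)

  length≡∑1 : ∀ (xs : List A) → length xs ≡ ∑[ _ ∈ xs ] 1
  length≡∑1 xs = trans (sym (*-identityʳ (length xs))) (sym (∑-const xs 1))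

  ∑-distrib-+ : ∀ (xs : List A) (f g : A → ℕ) → ∑[ x ∈ xs ] (f x + g x) ≡ ∑ xs f + ∑ xs g
  ∑-distrib-+ []       f g = refl
  ∑-distrib-+ (x ∷ xs) f g =
    trans (cong (f x + g x +_) (∑-distrib-+ xs f g)) (interchange (f x) (g x) _ _)

  ∑-*ˡ : ∀ (xs : List A) c (f : A → ℕ) → ∑[ x ∈ xs ] (c * f x) ≡ c * ∑ xs f
  ∑-*ˡ []       c f = sym (*-zeroʳ c)
  ∑-*ˡ (x ∷ xs) c f = trans (cong (c * f x +_) (∑-*ˡ xs c f)) (sym (*-distribˡ-+ c (f x) _))

  ∑-% : ∀ (xs : List A) {f g : A → ℕ} d .{{_ : NonZero d}} →
        (∀ x → f x % d ≡ g x % d) → ∑ xs f % d ≡ ∑ xs g % d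
  ∑-% []       d eq = refl
  ∑-% (x ∷ xs) {f} {g} d eq = begin
    (f x + ∑ xs f) % d         ≡⟨ %-distribˡ-+ (f x) _ d ⟩
    (f x % d + ∑ xs f % d) % d ≡⟨ cong₂ (λ a b → (a + b) % d) (eq x) (∑-% xs d eq) ⟩
    (g x % d + ∑ xs g % d) % d ≡⟨ %-distribˡ-+ (g x) _ d ⟨
    (g x + ∑ xs g) % d         ∎
    where open ≡-Reasoning

  ∑-↭ : ∀ {xs ys : List A} (f : A → ℕ) → xs ↭ ys → ∑ xs f ≡ ∑ ys f
  ∑-↭ f xs↭ys = sum-↭ (↭.map⁺ f xs↭ys)

  length-filter : ∀ {p} {P : Pred A p} (P? : Decidable P) (xs : List A) →
                  length (filter P? xs) ≡ ∑[ x ∈ xs ] 𝟙 (P? x)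
  length-filter P? []       = refl
  length-filter P? (x ∷ xs) with P? x
  ... | yes _ = cong suc (length-filter P? xs)
  ... | no  _ = length-filter P? xs

∑-map : ∀ {a b} {A : Set a} {B : Set b} (g : A → B) (xs : List A) (f : B → ℕ) →
        ∑ (map g xs) f ≡ ∑ xs (f ∘ g)
∑-map g xs f = cong sum (sym (Listₚ.map-∘ xs))

∑-comm : ∀ {a b} {A : Set a} {B : Set b} (xs : List A) (ys : List B) (F : A → B → ℕ) →
         ∑[ x ∈ xs ] ∑ ys (F x) ≡ ∑[ y ∈ ys ] ∑[ x ∈ xs ] F x y
∑-comm []       ys F = trans (sym (*-zeroʳ (length ys))) (sym (∑-const ys 0))
∑-comm (x ∷ xs) ys F = trans (cong (∑ ys (F x) +_) (∑-comm xs ys F)) (sym (∑-distrib-+ ys (F x) _))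

∑-allFin-suc : ∀ m (f : Fin (suc m) → ℕ) → ∑ (allFin (suc m)) f ≡ f zero + ∑[ j ∈ allFin m ] f (suc j)
∑-allFin-suc m f = cong (λ xs → f zero + sum xs)
  (trans (Listₚ.map-tabulate suc f) (sym (Listₚ.map-tabulate id (f ∘ suc))))

∑-allFin-const : ∀ m c → ∑[ _ ∈ allFin m ] c ≡ m * c
∑-allFin-const m c = trans (∑-const (allFin m) c) (cong (_* c) (Listₚ.length-tabulate {n = m} id))

∑-allFin-1 : ∀ m → ∑[ _ ∈ allFin m ] 1 ≡ m
∑-allFin-1 m = trans (∑-allFin-const m 1) (*-identityʳ m)

∑-reindex : ∀ {a} {A : Set a} {xs : List A} → Unique xs → (φ : A ↔ A) →
            (∀ {x} → x ∈ xs → Inverse.to φ x ∈ xs) → (∀ {y} → y ∈ xs → Inverse.from φ y ∈ xs) →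
            (f : A → ℕ) → ∑[ x ∈ xs ] f (Inverse.to φ x) ≡ ∑ xs f
∑-reindex {xs = xs} xs! φ to∈ from∈ f = begin
  ∑[ x ∈ xs ] f (to x)
    ≡⟨ ∑-map to xs f ⟨
  ∑ (map to xs) f
    ≡⟨ ∑-↭ f (∼bag⇒↭ (unique∧set⇒bag (Unique.map⁺ to-injective xs!) xs! (mk⇔ ⇒ ⇐))) ⟩
  ∑ xs f
    ∎
  where
  open ≡-Reasoning
  open Inverse φ
  to-injective : Injective _≡_ _≡_ to
  to-injective {x} {y} eq = trans (sym (strictlyInverseʳ x)) (trans (cong from eq) (strictlyInverseʳ y))
  ⇒ : ∀ {y} → y ∈ map to xs → y ∈ xs
  ⇒ y∈ with x , x∈ , refl ← ∈-map⁻ to y∈ = to∈ x∈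
  ⇐ : ∀ {y} → y ∈ xs → y ∈ map to xs
  ⇐ {y} y∈ = subst (_∈ map to xs) (strictlyInverseˡ y) (∈-map⁺ to (from∈ y∈))

injective⇒surjective : ∀ {m} (f : Fin m → Fin m) → Injective _≡_ _≡_ f → StrictlySurjective _≡_ f
injective⇒surjective {suc m} f f-inj y with Finₚ.any? (λ x → f x Finₚ.≟ y)
... | yes hit = hit
... | no miss = ⊥-elim (Finₚ.<⇒notInjective (n<1+n m) f′-injective)
  where
  f′ : Fin (suc m) → Fin m
  f′ x = Fin.punchOut (λ y≡fx → miss (x , sym y≡fx))
  f′-injective : Injective _≡_ _≡_ f′
  f′-injective eq = f-inj (Finₚ.punchOut-injective {i = y} _ _ eq)

surjective⇒permutation : ∀ {m} (f : Fin m → Fin m) → StrictlySurjective _≡_ f → Permutation′ m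
surjective⇒permutation f f-surj = permutation f g (proj₂ ∘ f-surj) g∘f
  where
  g = proj₁ ∘ f-surj
  g-injective : Injective _≡_ _≡_ g
  g-injective {x} {y} eq = trans (sym (proj₂ (f-surj x))) (trans (cong f eq) (proj₂ (f-surj y)))
  g∘f : ∀ x → g (f x) ≡ x
  g∘f x with y , refl ← injective⇒surjective g g-injective x = cong g (proj₂ (f-surj y))

permutation-surjective : ∀ {n} (π : Permutation′ n) → StrictlySurjective _≡_ (π ⟨$⟩ʳ_)
permutation-surjective π i = π ⟨$⟩ˡ i , inverseʳ π

∑-allFin-injective : ∀ {m} (g : Fin m → Fin m) → Injective _≡_ _≡_ g →
                     (f : Fin m → ℕ) → ∑[ j ∈ allFin m ] f (g j) ≡ ∑ (allFin m) f
∑-allFin-injective {m} g g-inj = ∑-reindex (Unique.allFin⁺ m)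
  (surjective⇒permutation g (injective⇒surjective g g-inj)) (λ _ → ∈-allFin _) (λ _ → ∈-allFin _)

injective⇒∃-↑ˡ : ∀ {r t} → t < r → (g : Fin r → Fin (r + t)) → Injective _≡_ _≡_ g →
                 ∃₂ λ y j → g y ≡ j ↑ˡ t
injective⇒∃-↑ˡ {r} {t} t<r g g-inj with Finₚ.any? (λ y → Finₚ.any? (λ j → g y Finₚ.≟ j ↑ˡ t))
... | yes hit  = hit
... | no  none = ⊥-elim (Finₚ.<⇒notInjective t<r (proj₁∘right-injective))
  where
  right : ∀ y → ∃[ k ] r ↑ʳ k ≡ g y
  right y with splitAt r (g y) in eq
  ... | inj₁ j = ⊥-elim (none (y , j , sym (Finₚ.splitAt⁻¹-↑ˡ eq)))
  ... | inj₂ k = k , Finₚ.splitAt⁻¹-↑ʳ eq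
  proj₁∘right-injective : Injective _≡_ _≡_ (proj₁ ∘ right)
  proj₁∘right-injective {x} {y} eq =
    g-inj (trans (sym (proj₂ (right x))) (trans (cong (r ↑ʳ_) eq) (proj₂ (right y))))

concatMap-map : ∀ {a b c} {A : Set a} {B : Set b} {C : Set c} (f : A → B → C) xs ys →
                concatMap (λ x → map (f x) ys) xs ≡ cartesianProductWith f xs ys
concatMap-map f []       ys = refl
concatMap-map f (x ∷ xs) ys = cong (map (f x) ys List.++_) (concatMap-map f xs ys)

allFuns-unique : ∀ n m → Unique (allFuns n m)
allFuns-unique zero    m = [] ∷ []
allFuns-unique (suc n) m = subst Unique (sym (concatMap-map _∷_ (allFin m) (allFuns n m)))
  (Unique.cartesianProductWith⁺ _∷_ Vecₚ.∷-injective (Unique.allFin⁺ m) (allFuns-unique n m))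

∈-allFuns : ∀ {n m} (v : Vec (Fin m) n) → v ∈ allFuns n m
∈-allFuns []                  = here refl
∈-allFuns {suc n} {m} (x ∷ v) = subst ((x ∷ v) ∈_) (sym (concatMap-map _∷_ (allFin m) (allFuns n m)))
  (∈-cartesianProductWith⁺ _∷_ (∈-allFin x) (∈-allFuns v))

module _ {n m : ℕ} where

  ∈-allSurj : ∀ (v : Vec (Fin m) n) → Surjective v → v ∈ allSurj n m
  ∈-allSurj v = ∈-filter⁺ surjective? (∈-allFuns v)

  ∈-allSurj⁻ : ∀ {v : Vec (Fin m) n} → v ∈ allSurj n m → Surjective v
  ∈-allSurj⁻ = proj₂ ∘ ∈-filter⁻ surjective? {xs = allFuns n m}

  ∑-allSurj-reindex : (φ : Vec (Fin m) n ↔ Vec (Fin m) n) →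
                      (∀ v → Surjective v → Surjective (Inverse.to φ v)) →
                      (∀ v → Surjective v → Surjective (Inverse.from φ v)) →
                      (f : Vec (Fin m) n → ℕ) → ∑[ v ∈ allSurj n m ] f (Inverse.to φ v) ≡ ∑ (allSurj n m) f
  ∑-allSurj-reindex φ to-surj from-surj = ∑-reindex (Unique.filter⁺ surjective? (allFuns-unique n m)) φ
    (λ {v} → ∈-allSurj _ ∘ to-surj v ∘ ∈-allSurj⁻) (λ {v} → ∈-allSurj _ ∘ from-surj v ∘ ∈-allSurj⁻)

rearrange : ∀ {a} {A : Set a} {m n} → (Fin n → Fin m) → Vec A m → Vec A n
rearrange ρ v = tabulate (lookup v ∘ ρ)

module _ {a} {A : Set a} where

  lookup-rearrange : ∀ {m n} (ρ : Fin n → Fin m) (v : Vec A m) i → lookup (rearrange ρ v) i ≡ lookup v (ρ i)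
  lookup-rearrange ρ v = Vecₚ.lookup∘tabulate (lookup v ∘ ρ)

  rearrange-∘ : ∀ {k m n} (ρ : Fin n → Fin m) (σ : Fin m → Fin k) (v : Vec A k) →
                rearrange ρ (rearrange σ v) ≡ rearrange (σ ∘ ρ) v
  rearrange-∘ ρ σ v = Vecₚ.tabulate-cong (lookup-rearrange σ v ∘ ρ)

  rearrange-id : ∀ {n} {ρ : Fin n → Fin n} → (∀ i → ρ i ≡ i) → (v : Vec A n) → rearrange ρ v ≡ v
  rearrange-id ρ≗id v = trans (Vecₚ.tabulate-cong (cong (lookup v) ∘ ρ≗id)) (Vecₚ.tabulate∘lookup v)

  rearrange-map : ∀ {m n} (f : Fin m → Fin m) (s : Vec (Fin m) n) (v : Vec A m) →
                  rearrange (lookup (Vec.map f s)) v ≡ rearrange (lookup s) (rearrange f v)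
  rearrange-map f s v = Vecₚ.tabulate-cong λ i →
    trans (cong (lookup v) (Vecₚ.lookup-map i f s)) (sym (lookup-rearrange f v (lookup s i)))

  rearrange-↔ : ∀ {n} → Permutation′ n → Vec A n ↔ Vec A n
  rearrange-↔ π = mk↔ₛ′ (rearrange (π ⟨$⟩ʳ_)) (rearrange (π ⟨$⟩ˡ_))
    (λ v → trans (rearrange-∘ (π ⟨$⟩ʳ_) (π ⟨$⟩ˡ_) v) (rearrange-id (λ _ → inverseˡ π) v))
    (λ v → trans (rearrange-∘ (π ⟨$⟩ˡ_) (π ⟨$⟩ʳ_) v) (rearrange-id (λ _ → inverseʳ π) v))

map-↔ : ∀ {m n} → Permutation′ m → Vec (Fin m) n ↔ Vec (Fin m) n
map-↔ π = mk↔ₛ′ (Vec.map (π ⟨$⟩ʳ_)) (Vec.map (π ⟨$⟩ˡ_))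
  (λ s → trans (sym (Vecₚ.map-∘ _ _ s)) (trans (Vecₚ.map-cong (λ _ → inverseʳ π) s) (Vecₚ.map-id s)))
  (λ s → trans (sym (Vecₚ.map-∘ _ _ s)) (trans (Vecₚ.map-cong (λ _ → inverseˡ π) s) (Vecₚ.map-id s)))

rearrange-surjective : ∀ {k m n} {ρ : Fin n → Fin k} → StrictlySurjective _≡_ ρ →
                       (v : Vec (Fin m) k) → Surjective v → Surjective (rearrange ρ v)
rearrange-surjective {ρ = ρ} ρ-surj v v-surj y with i , refl ← v-surj y with j , refl ← ρ-surj i =
  j , lookup-rearrange ρ v j

map-surjective : ∀ {k m n} {f : Fin m → Fin k} → StrictlySurjective _≡_ f →
                 (s : Vec (Fin m) n) → Surjective s → Surjective (Vec.map f s)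
map-surjective {f = f} f-surj s s-surj y with x , refl ← f-surj y with i , refl ← s-surj x =
  i , Vecₚ.lookup-map i f s

sum-map-take : ∀ {a} {A : Set a} m {t} (u : Vec A (m + t)) (f : A → ℕ) →
               Vec.sum (Vec.map f (Vec.take m u)) ≡ ∑[ j ∈ allFin m ] f (lookup u (j ↑ˡ t))
sum-map-take zero    u       f = refl
sum-map-take (suc m) (x ∷ u) f = trans (cong (f x +_) (sum-map-take m u f))
                                       (sym (∑-allFin-suc m (λ j → f (lookup (x ∷ u) (j ↑ˡ _)))))

prime⇒odd : ∀ {p} → Prime p → 2 < p → ∃[ h ] p ≡ suc (2 * h)
prime⇒odd {p} p-prime 2<p = p / 2 , (begin
  p                 ≡⟨ m≡m%n+[m/n]*n p 2 ⟩
  p % 2 + p / 2 * 2 ≡⟨ cong₂ _+_ p%2≡1 (*-comm (p / 2) 2) ⟩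
  suc (2 * (p / 2)) ∎)
  where
  open ≡-Reasoning
  p%2≡1 : p % 2 ≡ 1
  p%2≡1 with p % 2 in p%2 | m%n<n p 2
  ... | 0 | _ with prime⇒irreducible p-prime (m%n≡0⇒n∣m p 2 p%2)
  ...   | inj₂ 2≡p = ⊥-elim (<⇒≢ 2<p 2≡p)
  p%2≡1 | 1           | _              = refl
  p%2≡1 | suc (suc _) | s≤s (s≤s ())

∑-toℕ-allFin : ∀ m → ∑ (allFin (suc m)) toℕ * 2 ≡ suc m * m
∑-toℕ-allFin zero    = refl
∑-toℕ-allFin (suc m) = begin
  ∑ (allFin (2 + m)) toℕ * 2              ≡⟨ cong (_* 2) (∑-allFin-suc (suc m) toℕ) ⟩
  ∑[ j ∈ allFin (suc m) ] (1 + toℕ j) * 2 ≡⟨ cong (_* 2) (∑-distrib-+ (allFin (suc m)) (λ _ → 1) toℕ) ⟩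
  (∑[ _ ∈ allFin (suc m) ] 1 + T) * 2     ≡⟨ cong (λ x → (x + T) * 2) (∑-allFin-1 (suc m)) ⟩
  (suc m + T) * 2                         ≡⟨ *-distribʳ-+ 2 (suc m) T ⟩
  suc m * 2 + T * 2                       ≡⟨ cong (suc m * 2 +_) (∑-toℕ-allFin m) ⟩
  suc m * 2 + suc m * m                   ≡⟨ *-distribˡ-+ (suc m) 2 m ⟨
  suc m * (2 + m)                         ≡⟨ *-comm (suc m) (2 + m) ⟩
  (2 + m) * suc m                         ∎
  where
  open ≡-Reasoning
  T = ∑ (allFin (suc m)) toℕ

odd⇒∣∑-toℕ-allFin : ∀ {m} → ∃[ h ] m ≡ suc (2 * h) → m ∣ ∑ (allFin m) toℕ
odd⇒∣∑-toℕ-allFin (h , refl) = divides h (*-cancelʳ-≡ _ _ 2 (begin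
  ∑ (allFin m) toℕ * 2 ≡⟨ ∑-toℕ-allFin (2 * h) ⟩
  m * (2 * h)          ≡⟨ solve 2 (λ m h → m :* (con 2 :* h) := h :* m :* con 2) refl m h ⟩
  h * m * 2            ∎))
  where
  open ≡-Reasoning
  open +-*-Solver
  m = suc (2 * h)

odd⇒∣triangular : ∀ {m} → ∃[ h ] m ≡ suc (2 * h) → m ∣ (m * (m + 1)) / 2
odd⇒∣triangular (h , refl) = subst (m ∣_) (sym (*-/-assoc m 2∣m+1)) (m∣m*n ((m + 1) / 2))
  where
  open +-*-Solver
  m = suc (2 * h)
  2∣m+1 : 2 ∣ m + 1
  2∣m+1 = divides (suc h) (solve 1 (λ h → con 1 :+ con 2 :* h :+ con 1 := (con 1 :+ h) :* con 2) refl h)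

∣∣m-n∣⇔∣m : ∀ {d} m {n} → d ∣ n → d ∣ ∣ m - n ∣ ⇔ d ∣ m
∣∣m-n∣⇔∣m {d} m {n} d∣n with ≤-total n m
... | inj₁ n≤m = subst (λ x → d ∣ x ⇔ d ∣ m) (sym (m≤n⇒∣n-m∣≡n∸m n≤m)) (mk⇔
  (λ d∣m∸n → ∣m∸n∣n⇒∣m d n≤m d∣m∸n d∣n)
  (λ d∣m → ∣m+n∣m⇒∣n (subst (d ∣_) (sym (m+[n∸m]≡n n≤m)) d∣m) d∣n))
... | inj₂ m≤n = subst (λ x → d ∣ x ⇔ d ∣ m) (sym (m≤n⇒∣m-n∣≡n∸m m≤n)) (mk⇔
  (λ d∣n∸m → ∣m+n∣m⇒∣n (subst (d ∣_) (sym (m∸n+n≡m m≤n)) d∣n) d∣n∸m)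
  (λ d∣m → ∣m+n∣m⇒∣n (subst (d ∣_) (sym (m+[n∸m]≡n m≤n)) d∣n) d∣m))

-- Bézout gives x k ≡ -1 or x k ≡ 1 (mod r); in the second case (r - 1) x works.
coprime⇒∃-negInverse : ∀ {k r} .{{_ : NonZero r}} → Coprime k r → ∃[ u ] r ∣ 1 + u * k
coprime⇒∃-negInverse {k} {suc r-1} k⊥r with coprime-Bézout k⊥r
... | Bézout.-+ x y 1+xk≡yr = x , divides y 1+xk≡yr
... | Bézout.+- x y 1+yr≡xk = r-1 * x , divides (1 + r-1 * y) (begin
  1 + r-1 * x * k             ≡⟨ cong suc (*-assoc r-1 x k) ⟩
  1 + r-1 * (x * k)           ≡⟨ cong (λ z → 1 + r-1 * z) 1+yr≡xk ⟨
  1 + r-1 * (1 + y * suc r-1) ≡⟨ solve 2 (λ r-1 y → con 1 :+ r-1 :* (con 1 :+ y :* (con 1 :+ r-1))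
                                                 := (con 1 :+ r-1 :* y) :* (con 1 :+ r-1)) refl r-1 y ⟩
  (1 + r-1 * y) * suc r-1     ∎)
  where
  open ≡-Reasoning
  open +-*-Solver

linear-congruence-solvable : ∀ {k r} .{{_ : NonZero r}} → Coprime k r → ∀ b → ∃[ c ] r ∣ b + toℕ {r} c * k
linear-congruence-solvable {k} {r} k⊥r b with u , r∣1+uk ← coprime⇒∃-negInverse k⊥r =
  fromℕ< (m%n<n (b * u) r) , subst (λ x → r ∣ b + x * k) (sym (Finₚ.toℕ-fromℕ< (m%n<n (b * u) r)))
    (∣m+n∣m⇒∣n (subst (r ∣_) split (∣n⇒∣m*n b r∣1+uk)) (n∣m*n (b * u / r * k)))
  where
  open ≡-Reasoning
  open +-*-Solver
  split : b * (1 + u * k) ≡ b * u / r * k * r + (b + b * u % r * k)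
  split = begin
    b * (1 + u * k)
      ≡⟨ solve 3 (λ b u k → b :* (con 1 :+ u :* k) := b :+ b :* u :* k) refl b u k ⟩
    b + b * u * k
      ≡⟨ cong (λ x → b + x * k) (m≡m%n+[m/n]*n (b * u) r) ⟩
    b + (b * u % r + b * u / r * r) * k
      ≡⟨ solve 5 (λ b ρ q r k → b :+ (ρ :+ q :* r) :* k := q :* k :* r :+ (b :+ ρ :* k))
                 refl b (b * u % r) (b * u / r) r k ⟩
    b * u / r * k * r + (b + b * u % r * k)
      ∎

module _ {r} .{{_ : NonZero r}} where

  infixl 6 _⊕_

  _⊕_ : Fin r → ℕ → Fin r
  y ⊕ a = fromℕ< (m%n<n (toℕ y + a) r)

  toℕ-⊕ : ∀ y a → toℕ (y ⊕ a) ≡ (toℕ y + a) % r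
  toℕ-⊕ y a = Finₚ.toℕ-fromℕ< (m%n<n (toℕ y + a) r)

  ⊕-⊕ : ∀ {a b} → r ∣ a + b → ∀ y → y ⊕ a ⊕ b ≡ y
  ⊕-⊕ {a} {b} r∣a+b y = Finₚ.toℕ-injective (begin
    toℕ (y ⊕ a ⊕ b)                   ≡⟨ toℕ-⊕ (y ⊕ a) b ⟩
    (toℕ (y ⊕ a) + b) % r             ≡⟨ cong (λ x → (x + b) % r) (toℕ-⊕ y a) ⟩
    ((toℕ y + a) % r + b) % r         ≡⟨ %-distribˡ-+ ((toℕ y + a) % r) b r ⟩
    ((toℕ y + a) % r % r + b % r) % r ≡⟨ cong (λ x → (x + b % r) % r) (m%n%n≡m%n (toℕ y + a) r) ⟩
    ((toℕ y + a) % r + b % r) % r     ≡⟨ %-distribˡ-+ (toℕ y + a) b r ⟨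
    (toℕ y + a + b) % r               ≡⟨ cong (_% r) (+-assoc (toℕ y) a b) ⟩
    (toℕ y + (a + b)) % r             ≡⟨ %-remove-+ʳ (toℕ y) r∣a+b ⟩
    toℕ y % r                         ≡⟨ m<n⇒m%n≡m (Finₚ.toℕ<n y) ⟩
    toℕ y                             ∎)
    where open ≡-Reasoning

-- Rotating the values of a surjection along a transversal

-- p picks one point in each fibre of v; rotate a moves p y to p (y ⊕ a) and fixes all other points,
-- so lookup v ∘ rotate a adds a (mod r) to the values on the transversal and nothing else.
module Rotation {n r} .{{_ : NonZero r}} (v : Vec (Fin r) n) (p : Fin r → Fin n)
                (section : ∀ y → lookup v (p y) ≡ y) where

  InTransversal : Fin n → Set
  InTransversal i = p (lookup v i) ≡ i

  inTransversal? : ∀ i → Dec (InTransversal i)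
  inTransversal? i = p (lookup v i) Finₚ.≟ i

  p-inTransversal : ∀ y → InTransversal (p y)
  p-inTransversal y = cong p (section y)

  rotate : ℕ → Fin n → Fin n
  rotate a i with inTransversal? i
  ... | yes _ = p (lookup v i ⊕ a)
  ... | no  _ = i

  rotate-p : ∀ a y → rotate a (p y) ≡ p (y ⊕ a)
  rotate-p a y with inTransversal? (p y)
  ... | yes _   = cong (λ x → p (x ⊕ a)) (section y)
  ... | no  p∉T = ⊥-elim (p∉T (p-inTransversal y))

  rotate-∉ : ∀ a {i} → ¬ InTransversal i → rotate a i ≡ i
  rotate-∉ a {i} i∉T with inTransversal? i
  ... | yes i∈T = ⊥-elim (i∉T i∈T)
  ... | no  _   = refl

  rotate-rotate : ∀ {a b} → r ∣ a + b → ∀ i → rotate b (rotate a i) ≡ i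
  rotate-rotate {a} {b} r∣a+b i with inTransversal? i
  ... | yes i∈T = trans (rotate-p b _) (trans (cong p (⊕-⊕ r∣a+b _)) i∈T)
  ... | no  i∉T = rotate-∉ b i∉T

  rotation : Fin r → Permutation′ n
  rotation c = permutation (rotate (toℕ c)) (rotate (r ∸ toℕ c))
    (rotate-rotate (subst (r ∣_) (sym (m∸n+n≡m c≤r)) ∣-refl))
    (rotate-rotate (subst (r ∣_) (sym (m+[n∸m]≡n c≤r)) ∣-refl))
    where c≤r = <⇒≤ (Finₚ.toℕ<n c)

  toℕ-lookup-rotate : ∀ a i → toℕ (lookup v (rotate a i)) ≡ (toℕ (lookup v i) + a * 𝟙 (inTransversal? i)) % r
  toℕ-lookup-rotate a i with inTransversal? i
  ... | yes _ = begin
    toℕ (lookup v (p (lookup v i ⊕ a))) ≡⟨ cong toℕ (section _) ⟩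
    toℕ (lookup v i ⊕ a)                ≡⟨ toℕ-⊕ (lookup v i) a ⟩
    (toℕ (lookup v i) + a) % r          ≡⟨ cong (λ x → (toℕ (lookup v i) + x) % r) (*-identityʳ a) ⟨
    (toℕ (lookup v i) + a * 1) % r      ∎
    where open ≡-Reasoning
  ... | no _ = begin
    toℕ (lookup v i)                    ≡⟨ m<n⇒m%n≡m (Finₚ.toℕ<n (lookup v i)) ⟨
    toℕ (lookup v i) % r                ≡⟨ cong (_% r) (+-identityʳ _) ⟨
    (toℕ (lookup v i) + 0) % r          ≡⟨ cong (λ x → (toℕ (lookup v i) + x) % r) (*-zeroʳ a) ⟨
    (toℕ (lookup v i) + a * 0) % r      ∎
    where open ≡-Reasoning

  ∑-rotate : ∀ {ℓ} {X : Set ℓ} (xs : List X) (pos : X → Fin n) a →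
             ∑[ x ∈ xs ] toℕ (lookup v (rotate a (pos x))) % r ≡
             (∑[ x ∈ xs ] toℕ (lookup v (pos x)) + a * ∑[ x ∈ xs ] 𝟙 (inTransversal? (pos x))) % r
  ∑-rotate xs pos a = begin
    ∑[ x ∈ xs ] toℕ (lookup v (rotate a (pos x))) % r
      ≡⟨ ∑-% xs r (λ x → trans (cong (_% r) (toℕ-lookup-rotate a (pos x))) (m%n%n≡m%n _ r)) ⟩
    ∑[ x ∈ xs ] (toℕ (lookup v (pos x)) + a * 𝟙 (inTransversal? (pos x))) % r
      ≡⟨ cong (_% r) (∑-distrib-+ xs _ _) ⟩
    (∑[ x ∈ xs ] toℕ (lookup v (pos x)) + ∑[ x ∈ xs ] (a * 𝟙 (inTransversal? (pos x)))) % r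
      ≡⟨ cong (λ y → (∑[ x ∈ xs ] toℕ (lookup v (pos x)) + y) % r) (∑-*ˡ xs a _) ⟩
    (∑[ x ∈ xs ] toℕ (lookup v (pos x)) + a * ∑[ x ∈ xs ] 𝟙 (inTransversal? (pos x))) % r
      ∎
    where open ≡-Reasoning

-- Counting good rearrangements

module Rearrangements (r t : ℕ) (r-prime : Prime r) (2<r : 2 < r) (t<r : t < r) where

  private instance
    r≢0 : NonZero r
    r≢0 = prime⇒nonZero r-prime

  1<r : 1 < r
  1<r = <-trans (n<1+n 1) 2<r

  r-odd : ∃[ h ] r ≡ suc (2 * h)
  r-odd = prime⇒odd r-prime 2<r

  n : ℕ
  n = r + t

  firstSum : Vec (Fin r) n → ℕ
  firstSum u = ∑[ j ∈ allFin r ] toℕ (lookup u (j ↑ˡ t))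

  Good : Vec (Fin r) n → Set
  Good u = r ∣ firstSum u

  good? : ∀ u → Dec (Good u)
  good? u = r ∣? firstSum u

  -- Permutations of the n positions are enumerated as the surjective s : Vec (Fin n) n.
  goodRearrangements : Vec (Fin r) n → ℕ
  goodRearrangements v = ∑[ s ∈ allSurj n n ] 𝟙 (good? (rearrange (lookup s) v))

  goodRearrangements-invariant : ∀ (π : Permutation′ n) v →
                                 goodRearrangements (rearrange (π ⟨$⟩ʳ_) v) ≡ goodRearrangements v
  goodRearrangements-invariant π v = begin
    ∑[ s ∈ allSurj n n ] 𝟙 (good? (rearrange (lookup s) (rearrange (π ⟨$⟩ʳ_) v)))
      ≡⟨ ∑-cong (allSurj n n) (λ {s} _ → cong (λ u → 𝟙 (good? u)) (rearrange-map (π ⟨$⟩ʳ_) s v)) ⟨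
    ∑[ s ∈ allSurj n n ] 𝟙 (good? (rearrange (lookup (Vec.map (π ⟨$⟩ʳ_) s)) v))
      ≡⟨ ∑-allSurj-reindex (map-↔ π) (map-surjective (permutation-surjective π))
                                     (map-surjective (permutation-surjective (flip π)))
                                     (λ s → 𝟙 (good? (rearrange (lookup s) v))) ⟩
    goodRearrangements v
      ∎
    where open ≡-Reasoning

  ∑goodRearrangements≡#permutations*#good :
    ∑ (allSurj n r) goodRearrangements ≡ length (allSurj n n) * ∑[ v ∈ allSurj n r ] 𝟙 (good? v)
  ∑goodRearrangements≡#permutations*#good = begin
    ∑[ v ∈ allSurj n r ] ∑[ s ∈ allSurj n n ] 𝟙 (good? (rearrange (lookup s) v))
      ≡⟨ ∑-comm (allSurj n r) (allSurj n n) (λ v s → 𝟙 (good? (rearrange (lookup s) v))) ⟩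
    ∑[ s ∈ allSurj n n ] ∑[ v ∈ allSurj n r ] 𝟙 (good? (rearrange (lookup s) v))
      ≡⟨ ∑-cong (allSurj n n) (λ s∈ → #good-invariant (surjective⇒permutation _ (∈-allSurj⁻ s∈))) ⟩
    ∑[ _ ∈ allSurj n n ] ∑[ v ∈ allSurj n r ] 𝟙 (good? v)
      ≡⟨ ∑-const (allSurj n n) _ ⟩
    length (allSurj n n) * ∑[ v ∈ allSurj n r ] 𝟙 (good? v)
      ∎
    where
    open ≡-Reasoning
    #good-invariant : ∀ π → ∑[ v ∈ allSurj n r ] 𝟙 (good? (rearrange (π ⟨$⟩ʳ_) v)) ≡
                            ∑[ v ∈ allSurj n r ] 𝟙 (good? v)
    #good-invariant π = ∑-allSurj-reindex (rearrange-↔ π) (rearrange-surjective (permutation-surjective π))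
                                          (rearrange-surjective (permutation-surjective (flip π))) (λ v → 𝟙 (good? v))

  module _ (v : Vec (Fin r) n) (p : Fin r → Fin n) (section : ∀ y → lookup v (p y) ≡ y) where

    open Rotation v p section

    rotated : Vec (Fin n) n → Fin r → Vec (Fin r) n
    rotated s c = rearrange (lookup s) (rearrange (rotate (toℕ c)) v)

    goodRotations : Vec (Fin n) n → ℕ
    goodRotations s = ∑[ c ∈ allFin r ] 𝟙 (good? (rotated s c))

    module _ (s : Vec (Fin n) n) where

      pos : Fin r → Fin n
      pos j = lookup s (j ↑ˡ t)

      base : ℕ
      base = ∑[ j ∈ allFin r ] toℕ (lookup v (pos j))

      #inTransversal : ℕ
      #inTransversal = ∑[ j ∈ allFin r ] 𝟙 (inTransversal? (pos j))

      AllInTransversal : Set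
      AllInTransversal = ∀ j → InTransversal (pos j)

      rotated-good : ∀ c → r ∣ base + toℕ c * #inTransversal → Good (rotated s c)
      rotated-good c r∣ = m%n≡0⇒n∣m _ r (begin
        firstSum (rotated s c) % r
          ≡⟨ cong (_% r) (∑-cong (allFin r) (λ {j} _ → cong toℕ (lookup-rotated j))) ⟩
        ∑[ j ∈ allFin r ] toℕ (lookup v (rotate (toℕ c) (pos j))) % r
          ≡⟨ ∑-rotate (allFin r) pos (toℕ c) ⟩
        (base + toℕ c * #inTransversal) % r
          ≡⟨ n∣m⇒m%n≡0 _ r r∣ ⟩
        0 ∎)
        where
        open ≡-Reasoning
        lookup-rotated : ∀ j → lookup (rotated s c) (j ↑ˡ t) ≡ lookup v (rotate (toℕ c) (pos j))
        lookup-rotated j = trans (lookup-rearrange (lookup s) (rearrange (rotate (toℕ c)) v) (j ↑ˡ t))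
                                 (lookup-rearrange (rotate (toℕ c)) v (pos j))

      good-rotation⇒1≤goodRotations : ∃[ c ] Good (rotated s c) → 1 ≤ goodRotations s
      good-rotation⇒1≤goodRotations (c , c-good) =
        subst (_≤ goodRotations s) (𝟙-yes c-good (good? (rotated s c)))
              (∈⇒≤∑ (λ c → 𝟙 (good? (rotated s c))) (∈-allFin c))

      allInTransversal⇒#inTransversal≡r : AllInTransversal → #inTransversal ≡ r
      allInTransversal⇒#inTransversal≡r all-in =
        trans (∑-cong (allFin r) (λ {j} _ → 𝟙-yes (all-in j) (inTransversal? (pos j)))) (∑-allFin-1 r)

      ¬allInTransversal⇒#inTransversal<r : ¬ AllInTransversal → #inTransversal < r
      ¬allInTransversal⇒#inTransversal<r ¬all-in
        with j , j∉T ← Finₚ.¬∀⟶∃¬ r _ (inTransversal? ∘ pos) ¬all-in =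
        subst (#inTransversal <_) (∑-allFin-1 r)
          (∑-mono-< (λ _ → 𝟙≤1 _) (∈-allFin j) (subst (_< 1) (sym (𝟙-no j∉T (inTransversal? (pos j)))) z<s))

      module _ (s-surj : Surjective s) where

        private
          π : Permutation′ n
          π = surjective⇒permutation (lookup s) s-surj

        π⁻¹∘p-injective : Injective _≡_ _≡_ ((π ⟨$⟩ˡ_) ∘ p)
        π⁻¹∘p-injective {x} {y} eq = trans (sym (section x)) (trans (cong (lookup v) p-eq) (section y))
          where p-eq = trans (sym (inverseʳ π)) (trans (cong (π ⟨$⟩ʳ_) eq) (inverseʳ π))

        some-inTransversal : ∃[ j ] InTransversal (pos j)
        some-inTransversal with y , j , eq ← injective⇒∃-↑ˡ t<r ((π ⟨$⟩ˡ_) ∘ p) π⁻¹∘p-injective =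
          j , subst InTransversal (trans (sym (inverseʳ π)) (cong (π ⟨$⟩ʳ_) eq)) (p-inTransversal y)

        0<#inTransversal : 0 < #inTransversal
        0<#inTransversal with j , j∈T ← some-inTransversal =
          subst (_≤ #inTransversal) (𝟙-yes j∈T _)
                (∈⇒≤∑ (λ j → 𝟙 (inTransversal? (pos j))) (∈-allFin j))

        ¬allInTransversal⇒coprime : ¬ AllInTransversal → Coprime #inTransversal r
        ¬allInTransversal⇒coprime ¬all-in = Coprime.sym
          (prime⇒coprime r-prime {{>-nonZero 0<#inTransversal}} (¬allInTransversal⇒#inTransversal<r ¬all-in))

        ¬allInTransversal⇒good-rotation : ¬ AllInTransversal → ∃[ c ] Good (rotated s c)
        ¬allInTransversal⇒good-rotation ¬all-in =
          map₂ (λ {c} → rotated-good c) (linear-congruence-solvable (¬allInTransversal⇒coprime ¬all-in) base)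

        allInTransversal⇒r∣base : AllInTransversal → r ∣ base
        allInTransversal⇒r∣base all-in =
          subst (r ∣_) (sym (∑-allFin-injective (lookup v ∘ pos) v∘pos-injective toℕ))
                (odd⇒∣∑-toℕ-allFin r-odd)
          where
          v∘pos-injective : Injective _≡_ _≡_ (lookup v ∘ pos)
          v∘pos-injective {x} {y} eq = Finₚ.↑ˡ-injective t x y (begin
            x ↑ˡ t                      ≡⟨ inverseˡ π ⟨
            π ⟨$⟩ˡ pos x                ≡⟨ cong (π ⟨$⟩ˡ_) (all-in x) ⟨
            π ⟨$⟩ˡ p (lookup v (pos x)) ≡⟨ cong (λ z → π ⟨$⟩ˡ p z) eq ⟩
            π ⟨$⟩ˡ p (lookup v (pos y)) ≡⟨ cong (π ⟨$⟩ˡ_) (all-in y) ⟩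
            π ⟨$⟩ˡ pos y                ≡⟨ inverseˡ π ⟩
            y ↑ˡ t                      ∎)
            where open ≡-Reasoning

        allInTransversal⇒goodRotations≡r : AllInTransversal → goodRotations s ≡ r
        allInTransversal⇒goodRotations≡r all-in =
          trans (∑-cong (allFin r) (λ {c} _ → 𝟙-yes (rotated-good c (r∣ c)) (good? (rotated s c))))
                (∑-allFin-1 r)
          where
          r∣ : ∀ c → r ∣ base + toℕ c * #inTransversal
          r∣ c = ∣m∣n⇒∣m+n (allInTransversal⇒r∣base all-in)
            (subst (λ x → r ∣ toℕ c * x) (sym (allInTransversal⇒#inTransversal≡r all-in)) (n∣m*n (toℕ c)))

        1≤goodRotations : 1 ≤ goodRotations s
        1≤goodRotations with Finₚ.all? (inTransversal? ∘ pos)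
        ... | yes all-in = subst (1 ≤_) (sym (allInTransversal⇒goodRotations≡r all-in)) (<⇒≤ 1<r)
        ... | no ¬all-in = good-rotation⇒1≤goodRotations (¬allInTransversal⇒good-rotation ¬all-in)

    r*goodRearrangements≡∑goodRotations : r * goodRearrangements v ≡ ∑ (allSurj n n) goodRotations
    r*goodRearrangements≡∑goodRotations = begin
      r * goodRearrangements v
        ≡⟨ ∑-allFin-const r _ ⟨
      ∑[ c ∈ allFin r ] goodRearrangements v
        ≡⟨ ∑-cong (allFin r) (λ {c} _ → goodRearrangements-invariant (rotation c) v) ⟨
      ∑[ c ∈ allFin r ] goodRearrangements (rearrange (rotation c ⟨$⟩ʳ_) v)
        ≡⟨ ∑-comm (allFin r) (allSurj n n) (λ c s → 𝟙 (good? (rotated s c))) ⟩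
      ∑ (allSurj n n) goodRotations
        ∎
      where open ≡-Reasoning

    ∈-allSurj⇒1≤goodRotations : ∀ {s} → s ∈ allSurj n n → 1 ≤ goodRotations s
    ∈-allSurj⇒1≤goodRotations {s} s∈ = 1≤goodRotations s (∈-allSurj⁻ s∈)

    #permutations≤r*goodRearrangements : length (allSurj n n) ≤ r * goodRearrangements v
    #permutations≤r*goodRearrangements = begin
      length (allSurj n n)          ≡⟨ length≡∑1 (allSurj n n) ⟩
      ∑[ _ ∈ allSurj n n ] 1        ≤⟨ ∑-mono-≤ (allSurj n n) ∈-allSurj⇒1≤goodRotations ⟩
      ∑ (allSurj n n) goodRotations ≡⟨ r*goodRearrangements≡∑goodRotations ⟨
      r * goodRearrangements v      ∎
      where open ≤-Reasoning

    #permutations<r*goodRearrangements : ∀ s → Surjective s → AllInTransversal s →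
                                         length (allSurj n n) < r * goodRearrangements v
    #permutations<r*goodRearrangements s s-surj all-in = begin-strict
      length (allSurj n n)          ≡⟨ length≡∑1 (allSurj n n) ⟩
      ∑[ _ ∈ allSurj n n ] 1        <⟨ ∑-mono-< ∈-allSurj⇒1≤goodRotations (∈-allSurj s s-surj) 1<goodRotations ⟩
      ∑ (allSurj n n) goodRotations ≡⟨ r*goodRearrangements≡∑goodRotations ⟨
      r * goodRearrangements v      ∎
      where
      open ≤-Reasoning
      1<goodRotations : 1 < goodRotations s
      1<goodRotations = subst (1 <_) (sym (allInTransversal⇒goodRotations≡r s s-surj all-in)) 1<r

  -- Defs shifts the values to {1, …, r}: this adds r to the sum, and r divides r(r + 1)/2 as r is odd.
  event⇔good : ∀ u → Event r t u ⇔ Good u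
  event⇔good u = mk⇔
    (λ event → ∣m+n∣m⇒∣n (Equivalence.to shifted (subst Shifted sum≡r+firstSum event)) ∣-refl)
    (λ good → subst Shifted (sym sum≡r+firstSum) (Equivalence.from shifted (∣m∣n⇒∣m+n ∣-refl good)))
    where
    B = (r * (r + 1)) / 2
    Shifted : ℕ → Set
    Shifted x = r ∣ ∣ x - B ∣
    shifted : r ∣ ∣ r + firstSum u - B ∣ ⇔ r ∣ r + firstSum u
    shifted = ∣∣m-n∣⇔∣m (r + firstSum u) (odd⇒∣triangular r-odd)
    sum≡r+firstSum : Vec.sum (Vec.map (λ x → suc (toℕ x)) (Vec.take r u)) ≡ r + firstSum u
    sum≡r+firstSum = begin
      Vec.sum (Vec.map (λ x → suc (toℕ x)) (Vec.take r u))
        ≡⟨ sum-map-take r u (λ x → suc (toℕ x)) ⟩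
      ∑[ j ∈ allFin r ] (1 + toℕ (lookup u (j ↑ˡ t)))
        ≡⟨ ∑-distrib-+ (allFin r) (λ _ → 1) (λ j → toℕ (lookup u (j ↑ˡ t))) ⟩
      ∑[ _ ∈ allFin r ] 1 + firstSum u
        ≡⟨ cong (_+ firstSum u) (∑-allFin-1 r) ⟩
      r + firstSum u
        ∎
      where open ≡-Reasoning

  #good≡numGood : ∑[ v ∈ allSurj n r ] 𝟙 (good? v) ≡ numGood r t
  #good≡numGood = sym (trans (length-filter (event? r t) (allSurj n r))
    (∑-cong (allSurj n r) λ {u} _ →
      𝟙-cong (Equivalence.to (event⇔good u)) (Equivalence.from (event⇔good u)) (event? r t u) (good? u)))

  -- For s = id every first position j ↑ˡ t lies on the transversal _↑ˡ t of v₀.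
  v₀ : Vec (Fin r) n
  v₀ = Vec.allFin r Vec.++ Vec.replicate t (fromℕ< (<⇒≤ 1<r))

  v₀-section : ∀ y → lookup v₀ (y ↑ˡ t) ≡ y
  v₀-section y = trans (Vecₚ.lookup-++ˡ (Vec.allFin r) _ y) (Vecₚ.lookup-allFin y)

  #permutations<r*goodRearrangements-v₀ : length (allSurj n n) < r * goodRearrangements v₀
  #permutations<r*goodRearrangements-v₀ =
    #permutations<r*goodRearrangements v₀ (_↑ˡ t) v₀-section (Vec.allFin n) (λ i → i , Vecₚ.lookup-allFin i)
      (λ j → subst InTransversal (sym (Vecₚ.lookup-allFin (j ↑ˡ t))) (p-inTransversal j))
    where open Rotation v₀ (_↑ˡ t) v₀-section

  numSurj<r*numGood : numSurj r t < r * numGood r t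
  numSurj<r*numGood = *-cancelˡ-< #perms _ _ (begin-strict
    #perms * numSurj r t                            ≡⟨ *-comm #perms _ ⟩
    length (allSurj n r) * #perms                   ≡⟨ ∑-const (allSurj n r) #perms ⟨
    ∑[ _ ∈ allSurj n r ] #perms                     <⟨ ∑-mono-< (λ {v} v∈ → bound v (∈-allSurj⁻ v∈))
                                                                (∈-allSurj v₀ v₀-surjective)
                                                                #permutations<r*goodRearrangements-v₀ ⟩
    ∑[ v ∈ allSurj n r ] (r * goodRearrangements v) ≡⟨ ∑-*ˡ (allSurj n r) r goodRearrangements ⟩
    r * ∑ (allSurj n r) goodRearrangements          ≡⟨ cong (r *_) ∑goodRearrangements≡#permutations*#good ⟩
    r * (#perms * ∑[ v ∈ allSurj n r ] 𝟙 (good? v)) ≡⟨ x*[y*z]≡y*[x*z] r #perms _ ⟩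
    #perms * (r * ∑[ v ∈ allSurj n r ] 𝟙 (good? v)) ≡⟨ cong (λ x → #perms * (r * x)) #good≡numGood ⟩
    #perms * (r * numGood r t)                      ∎)
    where
    open ≤-Reasoning
    #perms = length (allSurj n n)
    bound : ∀ v → Surjective v → #perms ≤ r * goodRearrangements v
    bound v v-surj = #permutations≤r*goodRearrangements v (proj₁ ∘ v-surj) (proj₂ ∘ v-surj)
    v₀-surjective : Surjective v₀
    v₀-surjective y = y ↑ˡ t , v₀-section y

lemma7p9 : ∀ (t : ℕ) → ∃[ r₀ ] (∀ (r : ℕ) → Prime r → r ≥ r₀ → numSurj r t < r * numGood r t)
lemma7p9 t = t + 3 , λ r r-prime r≥t+3 →
  Rearrangements.numSurj<r*numGood r t r-prime (≤-trans (m≤n+m 3 t) r≥t+3) (≤-trans (m<m+n t z<s) r≥t+3)
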